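{- Let $\Gamma$ be a nonempty finite set, let $A\subseteq\Gamma$ be non-trivial (i.e. $A\ne\emptyset$ and $A\ne\Gamma$), and let $\mathcal B\subseteq\mathcal P(\Gamma)$ be a non-empty family of generators. Then $D_\cap(A\mid\mathcal B)\le\rho(A,\mathcal B)^2$.
   Context: A sequence $A_1,\dots,A_t$ ($t\ge1$) of subsets of $\Gamma$ generates $A$ from $\mathcal B$ if $A_t=A$ and each $A_i$ equals $X\cup Y$ or $X\cap Y$ for some (not necessarily distinct) $X,Y\in\mathcal B\cup\{A_1,\dots,A_{i-1}\}$. $D_\cap(A\mid\mathcal B)$ is the minimum number of intersection steps over all sequences generating $A$ from $\mathcal B$ ($\infty$ if none). Cover complexity: let $U=\Gamma\setminus A$. A semi-filter over $U$ is a nonempty family $\mathcal F\subseteq\mathcal P(U)$ with $\emptyset\notin\mathcal F$ such that $U_1\in\mathcal F$ and $U_1\subseteq U_2\subseteq U$ imply $U_2\in\mathcal F$. $\mathcal F$ is above $w\in\Gamma$ if for every $B\in\mathcal B$ with $w\in B$ we have $B\cap U\in\mathcal F$. $\mathcal F$ preserves a pair $(E,H)$ of subsets of $U$ if $E,H\in\mathcal F$ imply $E\cap H\in\mathcal F$; it preserves a collection $\Lambda$ if it preserves each pair. $\rho(A,\mathcal B)$ is the minimum size of a collection $\Lambda$ of pairs of subsets of $U$ such that no semi-filter over $U$ that preserves $\Lambda$ is above some $a\in A$ ($\infty$ if none exists). -}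

module Defs where

open import Data.Nat using (ℕ; zero; suc)
open import Data.Bool using (Bool; true; false)
open import Data.Product using (Σ; ∃; ∃-syntax; _×_; _,_)
open import Data.Unit using (⊤; tt)
open import Data.Empty renaming (⊥ to Empty)
open import Data.List using (List; []; _∷_; _∷ʳ_)
open import Data.List.Membership.Propositional using () renaming (_∈_ to _∈ₗ_)
open import Data.List.Relation.Unary.All using (All)
open import Data.Fin using (Fin)
open import Data.Fin.Subset using (Subset; _∩_; _∪_; _⊆_; _∈_; ∁)
  renaming (⊥ to ∅)
open import Relation.Binary.PropositionalEquality using (_≡_)
open import Relation.Nullary using (¬_)

-- Γ = Fin n; subsets of Γ are `Subset n`; a family of subsets is a list.

data Op : Set where
  ∪op ∩op : Op

Step : ℕ → Set
Step n = Op × Subset n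

StepOK : ∀ {n} → List (Subset n) → Op → Subset n → Set
StepOK avail ∪op S = ∃[ X ] ∃[ Y ] (X ∈ₗ avail × Y ∈ₗ avail × S ≡ X ∪ Y)
StepOK avail ∩op S = ∃[ X ] ∃[ Y ] (X ∈ₗ avail × Y ∈ₗ avail × S ≡ X ∩ Y)

ValidSteps : ∀ {n} → List (Subset n) → List (Step n) → Set
ValidSteps avail [] = ⊤
ValidSteps avail ((o , S) ∷ rest) = StepOK avail o S × ValidSteps (S ∷ avail) rest

Generates : ∀ {n} → List (Subset n) → Subset n → List (Step n) → Set
Generates ℬ A seq =
  (∃[ pre ] ∃[ o ] seq ≡ pre ∷ʳ (o , A)) × ValidSteps ℬ seq

interCount : ∀ {n} → List (Step n) → ℕ
interCount [] = zero
interCount ((∪op , _) ∷ rest) = interCount rest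
interCount ((∩op , _) ∷ rest) = suc (interCount rest)

Family : ℕ → Set
Family n = Subset n → Bool

IsSemiFilter : ∀ {n} → Subset n → Family n → Set
IsSemiFilter U F =
  (∃[ X ] F X ≡ true) ×
  (F ∅ ≡ false) ×
  (∀ X → F X ≡ true → X ⊆ U) ×
  (∀ X Y → F X ≡ true → X ⊆ Y → Y ⊆ U → F Y ≡ true)

IsAbove : ∀ {n} → List (Subset n) → Subset n → Family n → Fin n → Set
IsAbove ℬ U F w = ∀ B → B ∈ₗ ℬ → w ∈ B → F (B ∩ U) ≡ true

PreservesPair : ∀ {n} → Family n → Subset n × Subset n → Set
PreservesPair F (E , H) = F E ≡ true → F H ≡ true → F (E ∩ H) ≡ true

Preserves : ∀ {n} → Family n → List (Subset n × Subset n) → Set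
Preserves F Λ = All (PreservesPair F) Λ

-- Λ is a collection of pairs of subsets of U such that no semi-filter over U
-- preserving Λ is above some a ∈ A.  ρ(A,ℬ) is the minimum length of such Λ.
IsCover : ∀ {n} → Subset n → List (Subset n) → List (Subset n × Subset n) → Set
IsCover A ℬ Λ =
  All (λ { (E , H) → E ⊆ ∁ A × H ⊆ ∁ A }) Λ ×
  (∀ F → IsSemiFilter (∁ A) F → Preserves F Λ →
     ∀ a → a ∈ A → ¬ IsAbove ℬ (∁ A) F a)

{-# OPTIONS --safe #-}
-- Write U = Γ ∖ A and say that X ⊆ U is traced at w by the available sets if X ⊇ Y ∩ U
-- for some available Y ∋ w.  For a pair (E, H), unions alone produce Z_E = ⋃ {Y : Y ∩ U ⊆ E}
-- and Z_H, and the single intersection Z_E ∩ Z_H makes E ∩ H traced wherever E and H both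
-- are; so one round closing every pair of Λ costs |Λ| intersections.  If ∅ is not traced at
-- a ∈ A, the sets traced at a (together with U) form a semi-filter above a, so by the cover
-- property some pair of Λ is broken at a: E and H are traced, E ∩ H is not.  A pair broken
-- after a round was not fully traced before it, so every round strictly increases the number
-- of pairs fully traced at a, which is positive from the start.  Hence after |Λ| rounds ∅ is
-- traced at every a ∈ A, and the union of the available Y with Y ∩ U = ∅ is then exactly A.
module Submission where

open import Defs
open import Data.Nat using (ℕ; _≤_; _^_)
open import Data.Product using (∃-syntax; _×_)
open import Data.List using (List; []; length)
open import Data.Fin.Subset using (Subset) renaming (⊥ to ∅; ⊤ to Γ)
open import Relation.Binary.PropositionalEquality using (_≢_)

open import Level using (0ℓ)
open import Function using (id; _∘_)
open import Data.Nat using (zero; suc; _+_; _*_; _<_; z≤n; s≤s)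
open import Data.Nat.Properties
  using (≤-trans; ≤-reflexive; ≤∧≢⇒<; <⇒≱; +-comm; +-identityʳ; *-identityʳ;
         +-mono-≤)
open import Data.Bool using (true)
import Data.Bool as Bool
open import Data.Product using (_,_; proj₁; proj₂)
open import Data.Sum using (_⊎_; inj₁; inj₂)
open import Data.Unit using (tt)
open import Data.Empty using (⊥-elim)
open import Data.List using (_∷_; _++_; _∷ʳ_; filter)
open import Data.List.Properties using (length-filter; filter-some)
open import Data.List.Membership.Propositional using (find; lose) renaming (_∈_ to _∈ₗ_)
open import Data.List.Membership.Propositional.Properties using (∈-filter⁺; ∈-filter⁻)
open import Data.List.Relation.Unary.Any using (Any; here; there; any?)
import Data.List.Relation.Unary.Any as Any
open import Data.List.Relation.Unary.All using (All; []; _∷_)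
import Data.List.Relation.Unary.All as All
open import Data.List.Relation.Unary.All.Properties using (all-filter; ¬All⇒Any¬)
open import Data.List.Relation.Binary.Subset.Propositional using () renaming (_⊆_ to _⊆ₗ_)
open import Data.List.Relation.Binary.Subset.Propositional.Properties using (Any-resp-⊆)
open import Data.List.Relation.Binary.Sublist.Propositional using (⊆-refl) renaming (_⊆_ to _⊑_)
open import Data.List.Relation.Binary.Sublist.Propositional.Properties using (filter⁺)
open import Data.List.Relation.Binary.Sublist.Heterogeneous.Properties
  using (length-mono-≤; toPointwise)
open import Data.List.Relation.Binary.Pointwise using (Pointwise-≡⇒≡)
open import Data.Fin using (Fin)
open import Data.Fin.Subset using (_∩_; _∪_; _⊆_; _∈_; ∁; Nonempty)
open import Data.Fin.Subset.Properties
  using (_∈?_; _⊆?_; nonempty?; Empty-unique; ⊆-trans; ⊆-antisym; ⊆⊤; ∉⊥; x∉∁p⇒x∈p; ∁p⊆∁q⇒p⊇q;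
         x∈p∩q⁺; x∈p∩q⁻; p∩q⊆p; p∩q⊆q; p⊆p∪q; q⊆p∪q; x∈p∪q⁻; ∪-idem)
  renaming (⊆-refl to ⊆ˢ-refl)
open import Relation.Binary.PropositionalEquality using (_≡_; refl; sym; trans; cong; subst)
open import Relation.Nullary using (¬_; Dec; yes; no; does; contradiction)
open import Relation.Nullary.Decidable using (dec-true; dec-false; _×-dec_; _⊎-dec_; _→-dec_)
open import Relation.Unary using (Pred; Decidable)

private
  variable
    n : ℕ
    av L L′ : List (Subset n)
    E H X Y Z : Subset n
    w : Fin n

witness : {P : Set} (P? : Dec P) → does P? ≡ true → P
witness (yes p) _ = p

does-counterexample : {P Q R : Set} (P? : Dec P) (Q? : Dec Q) (R? : Dec R) →
  ¬ (does P? ≡ true → does Q? ≡ true → does R? ≡ true) → P × Q × ¬ R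
does-counterexample (yes p) (yes q) (no ¬r) _ = p , q , ¬r
does-counterexample (yes _) (yes _) (yes _) ¬⇒ = ⊥-elim (¬⇒ λ _ _ → refl)
does-counterexample (yes _) (no _)  _       ¬⇒ = ⊥-elim (¬⇒ λ _ ())
does-counterexample (no _)  _       _       ¬⇒ = ⊥-elim (¬⇒ λ ())

preservesPair? : (F : Family n) → Decidable (PreservesPair F)
preservesPair? F (E , H) = (F E Bool.≟ true) →-dec ((F H Bool.≟ true) →-dec (F (E ∩ H) Bool.≟ true))

module _ {A : Set} {P Q : Pred A 0ℓ} (P? : Decidable P) (Q? : Decidable Q) where

  -- Equal lengths would make the sublist filter P? xs ⊑ filter Q? xs the whole of filter Q? xs.
  length-filter-< : (∀ {x} → P x → Q x) → ∀ {x xs} → x ∈ₗ xs → Q x → ¬ P x →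
                    length (filter P? xs) < length (filter Q? xs)
  length-filter-< P⇒Q {x} {xs} x∈xs Qx ¬Px = ≤∧≢⇒< (length-mono-≤ P⊑Q) λ same →
      ¬Px (proj₂ (∈-filter⁻ P? {xs = xs}
        (subst (x ∈ₗ_) (sym (Pointwise-≡⇒≡ (toPointwise {as = filter P? xs} same P⊑Q)))
          (∈-filter⁺ Q? x∈xs Qx))))
    where
      P⊑Q : filter P? xs ⊑ filter Q? xs
      P⊑Q = filter⁺ P? Q? {as = xs} (λ { refl → P⇒Q }) ⊆-refl

≢∅⇒Nonempty : {A : Subset n} → A ≢ ∅ → Nonempty A
≢∅⇒Nonempty {A = A} A≢∅ with nonempty? A
... | yes ne = ne
... | no ¬ne = contradiction (Empty-unique ¬ne) A≢∅

≢Γ⇒∁-Nonempty : {A : Subset n} → A ≢ Γ → Nonempty (∁ A)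
≢Γ⇒∁-Nonempty {A = A} A≢Γ with nonempty? (∁ A)
... | yes ne = ne
... | no ¬ne = contradiction (⊆-antisym ⊆⊤ (∁p⊆∁q⇒p⊇q λ x∈∁A → ⊥-elim (¬ne (_ , x∈∁A)))) A≢Γ

p∩∁q⊆∅⇒p⊆q : {P Q : Subset n} → P ∩ ∁ Q ⊆ ∅ → P ⊆ Q
p∩∁q⊆∅⇒p⊆q P∩∁Q⊆∅ x∈P = x∉∁p⇒x∈p λ x∈∁Q → ∉⊥ (P∩∁Q⊆∅ (x∈p∩q⁺ (x∈P , x∈∁Q)))

available : List (Subset n) → List (Step n) → List (Subset n)
available av [] = av
available av ((_ , S) ∷ steps) = available (S ∷ av) steps

available-⊇ : ∀ av (steps : List (Step n)) → av ⊆ₗ available av steps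
available-⊇ av [] = id
available-⊇ av ((_ , S) ∷ steps) = available-⊇ (S ∷ av) steps ∘ there

available-++ : ∀ av (s t : List (Step n)) → available av (s ++ t) ≡ available (available av s) t
available-++ av [] t = refl
available-++ av ((_ , S) ∷ s) t = available-++ (S ∷ av) s t

ValidSteps-++ : ∀ av (s t : List (Step n)) →
  ValidSteps av s → ValidSteps (available av s) t → ValidSteps av (s ++ t)
ValidSteps-++ av [] t _ valid = valid
ValidSteps-++ av ((_ , S) ∷ s) t (ok , valid-s) valid-t =
  ok , ValidSteps-++ (S ∷ av) s t valid-s valid-t

interCount-++ : (s t : List (Step n)) → interCount (s ++ t) ≡ interCount s + interCount t
interCount-++ [] t = refl
interCount-++ ((∪op , _) ∷ s) t = interCount-++ s t
interCount-++ ((∩op , _) ∷ s) t = cong suc (interCount-++ s t)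

record Reach (av : List (Subset n)) (c : ℕ) (Q : List (Subset n) → Set) : Set where
  constructor reach
  field
    steps : List (Step n)
    valid : ValidSteps av steps
    cost  : interCount steps ≤ c
    goal  : Q (available av steps)

pure : {Q : List (Subset n) → Set} → Q av → Reach av 0 Q
pure q = reach [] tt z≤n q

module _ {Q R : List (Subset n) → Set} where

  bind : ∀ {c d} → Reach av c Q → (∀ {av′} → av ⊆ₗ av′ → Q av′ → Reach av′ d R) → Reach av (c + d) R
  bind {av = av} (reach s valid-s cost-s q) next with next (available-⊇ av s) q
  ... | reach t valid-t cost-t r =
    reach (s ++ t) (ValidSteps-++ av s t valid-s valid-t)
      (subst (_≤ _) (sym (interCount-++ s t)) (+-mono-≤ cost-s cost-t))
      (subst R (sym (available-++ av s t)) r)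

  mapGoal : ∀ {c} → (∀ {av′} → av ⊆ₗ av′ → Q av′ → R av′) → Reach av c Q → Reach av c R
  mapGoal {av = av} f (reach s valid cost q) = reach s valid cost (f (available-⊇ av s) q)

relax : ∀ {c d} {Q : List (Subset n) → Set} → c ≤ d → Reach av c Q → Reach av d Q
relax c≤d (reach s valid cost q) = reach s valid (≤-trans cost c≤d) q

unite : X ∈ₗ av → Y ∈ₗ av → Reach av 0 ((X ∪ Y) ∈ₗ_)
unite {X = X} {Y = Y} x y =
  reach ((∪op , X ∪ Y) ∷ []) ((X , Y , x , y , refl) , tt) z≤n (here refl)

intersect : X ∈ₗ av → Y ∈ₗ av → Reach av 1 ((X ∩ Y) ∈ₗ_)
intersect {X = X} {Y = Y} x y =
  reach ((∩op , X ∩ Y) ∷ []) ((X , Y , x , y , refl) , tt) (s≤s z≤n) (here refl)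

reachUnion : {P : Subset n → Set} → (∀ {Y Z} → P Y → P Z → P (Y ∪ Z)) →
  ∀ Z M → All P (Z ∷ M) → All (_∈ₗ av) (Z ∷ M) →
  Reach av 0 (λ av′ → ∃[ W ] (W ∈ₗ av′ × P W × All (_⊆ W) (Z ∷ M)))
reachUnion ∪-closed Z [] (pZ ∷ []) (z ∷ []) = pure (Z , z , pZ , ⊆ˢ-refl ∷ [])
reachUnion ∪-closed Z (Y ∷ M) (pZ ∷ pY ∷ pM) (z ∷ y ∷ ms) =
  bind (unite z y) λ grow z∪y →
  mapGoal (λ { _ (W , w , pW , Z∪Y⊆W ∷ M⊆W) →
               W , w , pW , ⊆-trans (p⊆p∪q Y) Z∪Y⊆W ∷ ⊆-trans (q⊆p∪q Z Y) Z∪Y⊆W ∷ M⊆W })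
    (reachUnion ∪-closed (Z ∪ Y) M (∪-closed pZ pY ∷ pM) (z∪y ∷ All.map grow ms))

generated : {ℬ : List (Subset n)} {A : Subset n} {c : ℕ} →
  Reach ℬ c (A ∈ₗ_) → ∃[ seq ] (Generates ℬ A seq × interCount seq ≤ c)
generated {ℬ = ℬ} {A} (reach s valid cost a) =
  s ∷ʳ (∪op , A) ,
  ((s , ∪op , refl) , ValidSteps-++ ℬ s _ valid ((A , A , a , a , sym (∪-idem A)) , tt)) ,
  subst (_≤ _) (sym (trans (interCount-++ s _) (+-identityʳ _))) cost

module Traces {n : ℕ} (U : Subset n) where

  Traced : List (Subset n) → Fin n → Subset n → Set
  Traced L w X = Any (λ Y → w ∈ Y × Y ∩ U ⊆ X) L

  traced? : ∀ L w X → Dec (Traced L w X)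
  traced? L w X = any? (λ Y → (w ∈? Y) ×-dec (Y ∩ U ⊆? X)) L

  Traced-up : X ⊆ Y → Traced L w X → Traced L w Y
  Traced-up X⊆Y = Any.map λ (w∈ , ⊆X) → w∈ , ⊆-trans ⊆X X⊆Y

  ∩U-∪ : X ∩ U ⊆ E → Y ∩ U ⊆ E → (X ∪ Y) ∩ U ⊆ E
  ∩U-∪ {X = X} {Y = Y} X⊆E Y⊆E z∈ with x∈p∩q⁻ (X ∪ Y) U z∈
  ... | z∈X∪Y , z∈U with x∈p∪q⁻ X Y z∈X∪Y
  ...   | inj₁ z∈X = X⊆E (x∈p∩q⁺ (z∈X , z∈U))
  ...   | inj₂ z∈Y = Y⊆E (x∈p∩q⁺ (z∈Y , z∈U))

  ∩U-∩ : X ∩ U ⊆ E → Y ∩ U ⊆ H → (X ∩ Y) ∩ U ⊆ E ∩ H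
  ∩U-∩ {X = X} {Y = Y} X⊆E Y⊆H z∈ with x∈p∩q⁻ (X ∩ Y) U z∈
  ... | z∈X∩Y , z∈U with x∈p∩q⁻ X Y z∈X∩Y
  ...   | z∈X , z∈Y = x∈p∩q⁺ (X⊆E (x∈p∩q⁺ (z∈X , z∈U)) , Y⊆H (x∈p∩q⁺ (z∈Y , z∈U)))

  collect : ∀ E → Any (λ Y → Y ∩ U ⊆ E) av →
    Reach av 0 (λ av′ → ∃[ Z ] (Z ∈ₗ av′ × Z ∩ U ⊆ E × ∀ {w} → Traced av w E → w ∈ Z))
  collect {av = av} E bounded with find bounded
  ... | Y₀ , y₀ , Y₀⊆E =
    mapGoal (λ { _ (Z , z , Z⊆E , _ ∷ M⊆Z) → Z , z , Z⊆E , covered M⊆Z })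
      (reachUnion {P = λ X → X ∩ U ⊆ E} ∩U-∪ Y₀ M (Y₀⊆E ∷ all-filter bounded? av)
        (y₀ ∷ All.tabulate (proj₁ ∘ ∈-filter⁻ bounded? {xs = av})))
    where
      bounded? : ∀ Y → Dec (Y ∩ U ⊆ E)
      bounded? Y = Y ∩ U ⊆? E
      M : List (Subset n)
      M = filter bounded? av
      covered : All (_⊆ Z) M → Traced av w E → w ∈ Z
      covered M⊆Z t with find t
      ... | Y , y , w∈Y , Y⊆E = All.lookup M⊆Z (∈-filter⁺ bounded? y Y⊆E) w∈Y

  Closes : List (Subset n) → List (Subset n) → Subset n × Subset n → Set
  Closes L L′ (E , H) = ∀ {w} → Traced L w E → Traced L w H → Traced L′ w (E ∩ H)

  closePair : ∀ av p → Reach av 1 (λ av′ → Closes av av′ p)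
  closePair av (E , H) with any? (λ Y → Y ∩ U ⊆? E) av | any? (λ Y → Y ∩ U ⊆? H) av
  ... | no ¬bE | _ = relax z≤n (pure λ tE _ → ⊥-elim (¬bE (Any.map proj₂ tE)))
  ... | yes _ | no ¬bH = relax z≤n (pure λ _ tH → ⊥-elim (¬bH (Any.map proj₂ tH)))
  ... | yes bE | yes bH =
    bind (collect E bE) λ grow (ZE , zE , ZE⊆E , coveredE) →
    bind (collect H (Any-resp-⊆ grow bH)) λ grow′ (ZH , zH , ZH⊆H , coveredH) →
    mapGoal (λ _ zEH tE tH →
               lose zEH (x∈p∩q⁺ (coveredE tE , coveredH (Any-resp-⊆ grow tH)) , ∩U-∩ ZE⊆E ZH⊆H))
      (intersect (grow′ zE) zH)

  Closes-growʳ : L ⊆ₗ L′ → ∀ {p} → Closes av L p → Closes av L′ p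
  Closes-growʳ L⊆L′ {E , H} closes tE tH = Any-resp-⊆ L⊆L′ (closes tE tH)

  Closes-growˡ : av ⊆ₗ L → ∀ {p} → Closes L L′ p → Closes av L′ p
  Closes-growˡ av⊆L {E , H} closes tE tH = closes (Any-resp-⊆ av⊆L tE) (Any-resp-⊆ av⊆L tH)

  closeAll : ∀ av Λ → Reach av (length Λ) (λ av′ → All (Closes av av′) Λ)
  closeAll av [] = pure []
  closeAll av (p ∷ Λ) =
    bind (closePair av p) λ grow closes →
    mapGoal (λ grow′ closesΛ → Closes-growʳ grow′ closes ∷ All.map (Closes-growˡ grow) closesΛ)
      (closeAll _ Λ)

  -- The semi-filter over U generated at a by the traces Y ∩ U of the available sets Y ∋ a;
  -- U is added so that it is never empty, even when no available set contains a.
  InTraceFilter : List (Subset n) → Fin n → Subset n → Set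
  InTraceFilter L a X = X ⊆ U × (U ⊆ X ⊎ Traced L a X)

  inTraceFilter? : ∀ L a X → Dec (InTraceFilter L a X)
  inTraceFilter? L a X = (X ⊆? U) ×-dec ((U ⊆? X) ⊎-dec traced? L a X)

  traceFilter : List (Subset n) → Fin n → Family n
  traceFilter L a X = does (inTraceFilter? L a X)

  InTraceFilter-up : ∀ {a} → InTraceFilter L a X → X ⊆ Y → Y ⊆ U → InTraceFilter L a Y
  InTraceFilter-up (_ , inj₁ U⊆X) X⊆Y Y⊆U = Y⊆U , inj₁ (⊆-trans U⊆X X⊆Y)
  InTraceFilter-up (_ , inj₂ t)   X⊆Y Y⊆U = Y⊆U , inj₂ (Traced-up X⊆Y t)

  traceFilter-isSemiFilter : ∀ {a} → Nonempty U → ¬ Traced L a ∅ →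
                             IsSemiFilter U (traceFilter L a)
  traceFilter-isSemiFilter {L = L} {a} (u , u∈U) ¬t∅ =
    (U , dec-true (in? U) (⊆ˢ-refl , inj₁ ⊆ˢ-refl)) ,
    dec-false (in? ∅) (λ { (_ , inj₁ U⊆∅) → ∉⊥ (U⊆∅ u∈U) ; (_ , inj₂ t∅) → ¬t∅ t∅ }) ,
    (λ X X∈F → proj₁ (witness (in? X) X∈F)) ,
    λ X Y X∈F X⊆Y Y⊆U → dec-true (in? Y) (InTraceFilter-up (witness (in? X) X∈F) X⊆Y Y⊆U)
    where
      in? : ∀ X → Dec (InTraceFilter L a X)
      in? = inTraceFilter? L a

  traceFilter-isAbove : ∀ {ℬ a} → ℬ ⊆ₗ L → IsAbove ℬ U (traceFilter L a) a
  traceFilter-isAbove {L = L} {a = a} ℬ⊆L B b a∈B =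
    dec-true (inTraceFilter? L a (B ∩ U)) (p∩q⊆q B U , inj₂ (lose (ℬ⊆L b) (a∈B , ⊆ˢ-refl)))

  Broken : List (Subset n) → Fin n → Subset n × Subset n → Set
  Broken L a (E , H) = Traced L a E × Traced L a H × ¬ Traced L a (E ∩ H)

  unpreserved⇒broken : ∀ {a p} → ¬ PreservesPair (traceFilter L a) p → Broken L a p
  unpreserved⇒broken {L = L} {a} {E , H} ¬pres
    with does-counterexample (inTraceFilter? L a E) (inTraceFilter? L a H)
                             (inTraceFilter? L a (E ∩ H)) ¬pres
  ... | (_ , inj₁ U⊆E) , inH@(H⊆U , _) , ∉E∩H =
    ⊥-elim (∉E∩H (InTraceFilter-up inH (λ x∈H → x∈p∩q⁺ (U⊆E (H⊆U x∈H) , x∈H))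
                                       (⊆-trans (p∩q⊆q E H) H⊆U)))
  ... | inE@(E⊆U , _) , (_ , inj₁ U⊆H) , ∉E∩H =
    ⊥-elim (∉E∩H (InTraceFilter-up inE (λ x∈E → x∈p∩q⁺ (x∈E , U⊆H (E⊆U x∈E)))
                                       (⊆-trans (p∩q⊆p E H) E⊆U)))
  ... | (E⊆U , inj₂ tE) , (_ , inj₂ tH) , ∉E∩H =
    tE , tH , λ tE∩H → ∉E∩H (⊆-trans (p∩q⊆p E H) E⊆U , inj₂ tE∩H)

module FromCover {n : ℕ} (A : Subset n) (ℬ : List (Subset n)) (Λ : List (Subset n × Subset n))
  (cover : IsCover A ℬ Λ) (A-nonempty : Nonempty A) (∁A-nonempty : Nonempty (∁ A)) where

  open Traces (∁ A)

  k : ℕ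
  k = length Λ

  brokenPair : ∀ {a} → ℬ ⊆ₗ L → a ∈ A → Traced L a ∅ ⊎ Any (Broken L a) Λ
  brokenPair {L = L} {a} ℬ⊆L a∈A with traced? L a ∅
  ... | yes t∅ = inj₁ t∅
  ... | no ¬t∅ = inj₂ (Any.map unpreserved⇒broken (¬All⇒Any¬ (preservesPair? F) Λ λ preserves →
        proj₂ cover F (traceFilter-isSemiFilter ∁A-nonempty ¬t∅) preserves a a∈A
          (traceFilter-isAbove ℬ⊆L)))
    where
      F : Family n
      F = traceFilter L a

  BothTraced : List (Subset n) → Fin n → Subset n × Subset n → Set
  BothTraced L a (E , H) = Traced L a E × Traced L a H

  bothTraced? : ∀ L a → Decidable (BothTraced L a)
  bothTraced? L a (E , H) = traced? L a E ×-dec traced? L a H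

  active : List (Subset n) → Fin n → ℕ
  active L a = length (filter (bothTraced? L a) Λ)

  active-grows : ∀ {a} → L ⊆ₗ L′ → All (Closes L L′) Λ → Any (Broken L′ a) Λ →
                 active L a < active L′ a
  active-grows {L = L} {L′} {a} L⊆L′ closes broken with find broken
  ... | (E , H) , p∈Λ , tE , tH , ¬tE∩H =
    length-filter-< (bothTraced? L a) (bothTraced? L′ a)
      (λ { {E′ , H′} (tE′ , tH′) → Any-resp-⊆ L⊆L′ tE′ , Any-resp-⊆ L⊆L′ tH′ })
      p∈Λ (tE , tH) (λ (tE₀ , tH₀) → ¬tE∩H (All.lookup closes p∈Λ tE₀ tH₀))

  Progress : ℕ → List (Subset n) → Set
  Progress r L = ∀ {a} → a ∈ A → Traced L a ∅ ⊎ r < active L a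

  progress₀ : Progress 0 ℬ
  progress₀ {a} a∈A with brokenPair id a∈A
  ... | inj₁ t∅ = inj₁ t∅
  ... | inj₂ broken =
    inj₂ (filter-some (bothTraced? ℬ a) (Any.map (λ (tE , tH , _) → tE , tH) broken))

  advance : ∀ {r} → ℬ ⊆ₗ L → L ⊆ₗ L′ → All (Closes L L′) Λ → Progress r L → Progress (suc r) L′
  advance ℬ⊆L L⊆L′ closes progress a∈A with progress a∈A | brokenPair (L⊆L′ ∘ ℬ⊆L) a∈A
  ... | inj₁ t∅ | _ = inj₁ (Any-resp-⊆ L⊆L′ t∅)
  ... | inj₂ _ | inj₁ t∅ = inj₁ t∅
  ... | inj₂ r<active | inj₂ broken =
    inj₂ (≤-trans (s≤s r<active) (active-grows L⊆L′ closes broken))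

  rounds : ∀ r → Reach ℬ (r * k) (Progress r)
  rounds zero = pure progress₀
  rounds (suc r) =
    relax (≤-reflexive (+-comm (r * k) k))
      (bind (rounds r) λ ℬ⊆L progress →
        mapGoal (λ L⊆L′ closes → advance ℬ⊆L L⊆L′ closes progress) (closeAll _ Λ))

  allTraced : Progress k L → ∀ {a} → a ∈ A → Traced L a ∅
  allTraced progress a∈A with progress a∈A
  ... | inj₁ t∅ = t∅
  ... | inj₂ k<active = contradiction (length-filter _ Λ) (<⇒≱ k<active)

  A-reachable : Reach ℬ (k ^ 2) (A ∈ₗ_)
  A-reachable =
    relax (≤-reflexive (trans (+-identityʳ (k * k)) (cong (k *_) (sym (*-identityʳ k)))))
      (bind (rounds k) λ _ progress →
        mapGoal (λ { _ (Z , z , Z∩∁A⊆∅ , covered) →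
                     subst (_∈ₗ _)
                       (⊆-antisym (p∩∁q⊆∅⇒p⊆q Z∩∁A⊆∅) (covered ∘ allTraced progress)) z })
          (collect ∅ (Any.map proj₂ (allTraced progress (proj₂ A-nonempty)))))

theorem3p6 : (n : ℕ) → 1 ≤ n → (A : Subset n) → A ≢ ∅ → A ≢ Γ →
    (ℬ : List (Subset n)) → ℬ ≢ [] →
    (Λ : List (Subset n × Subset n)) → IsCover A ℬ Λ →
    ∃[ seq ] (Generates ℬ A seq × interCount seq ≤ length Λ ^ 2)
theorem3p6 n _ A A≢∅ A≢Γ ℬ _ Λ cover =
  generated (FromCover.A-reachable A ℬ Λ cover (≢∅⇒Nonempty A≢∅) (≢Γ⇒∁-Nonempty A≢Γ))
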